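{- Let $n=bm$ where $b$ is even and $m$ is odd. Let $r$ be a nonnegative integer and $k$ an odd positive integer. Suppose $L=[L_{ij}]$ is a latin square of order $n$ indexed by $N_n=\{0,\dots,n-1\}$ such that \[\lfloor L_{ij}/m\rfloor\equiv\lfloor i/m\rfloor+\lfloor j/m\rfloor \pmod b\] for all $j\in N_n$ and all $0\le i<n-mr$. If $km^2r(r-1)<n$, then $L$ has no $k$-plexes.
   Context: A latin square of order $n$ on symbol set $N_n$ is viewed as a set of entries (row, column, symbol). A $k$-plex is a set of $kn$ entries containing exactly $k$ entries from each row and each column, with each symbol occurring exactly $k$ times. -}

module Defs where

open import Data.Nat using (ℕ; zero; suc; _+_; _*_; _/_)
open import Data.Nat.Divisibility using (_∣_)
open import Data.Bool using (Bool; true; false; _∧_)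
open import Data.Fin using (Fin; zero; suc; toℕ)
open import Data.Fin.Properties using (_≟_)
open import Data.Integer as ℤ using (ℤ; +_)
import Data.Integer.Divisibility as ℤd
open import Relation.Nullary.Decidable using (⌊_⌋)
open import Relation.Binary.PropositionalEquality using (_≡_)
open import Data.Product using (∃)

Even : ℕ → Set
Even n = 2 ∣ n

Odd : ℕ → Set
Odd n = Even n → Data.Empty.⊥
  where import Data.Empty

count : ∀ {n} → (Fin n → Bool) → ℕ
count {zero}  p = 0
count {suc n} p = (if p zero then 1 else 0) + count (λ x → p (suc x))
  where open import Data.Bool using (if_then_else_)

sumFin : ∀ {n} → (Fin n → ℕ) → ℕ
sumFin {zero}  f = 0
sumFin {suc n} f = f zero + sumFin (λ x → f (suc x))

count₂ : ∀ {n} → (Fin n → Fin n → Bool) → ℕ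
count₂ p = sumFin (λ i → count (p i))

Square : ℕ → Set
Square n = Fin n → Fin n → Fin n

IsLatin : ∀ {n} → Square n → Set
IsLatin {n} L =
  (∀ (i s : Fin n) → count (λ j → ⌊ L i j ≟ s ⌋) ≡ 1) Data.Product.×
  (∀ (j s : Fin n) → count (λ i → ⌊ L i j ≟ s ⌋) ≡ 1)
  where import Data.Product

-- a k-plex: a set K of entries (given by its cells, since the symbol of an
-- entry is determined by its cell) with exactly k entries in each row and
-- column and each symbol occurring exactly k times
IsKPlex : ∀ {n} → Square n → ℕ → (Fin n → Fin n → Bool) → Set
IsKPlex {n} L k K =
  (∀ (i : Fin n) → count (λ j → K i j) ≡ k) ×
  (∀ (j : Fin n) → count (λ i → K i j) ≡ k) ×
  (∀ (s : Fin n) → count₂ (λ i j → K i j ∧ ⌊ L i j ≟ s ⌋) ≡ k)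
  where open Data.Product using (_×_)

HasKPlex : ∀ {n} → Square n → ℕ → Set
HasKPlex {n} L k = ∃ λ (K : Fin n → Fin n → Bool) → IsKPlex L k K

-- floor division (m = 0 never used: m is odd in the theorem)
_div_ : ℕ → ℕ → ℕ
a div zero = 0
a div suc m = a / suc m

_≡_[mod_] : ℕ → ℕ → ℕ → Set
a ≡ c [mod b ] = (+ b) ℤd.∣ ((+ a) ℤ.- (+ c))

module Submission where

-- Cut rows, columns and symbols into b blocks of m consecutive values and, for a cell (i, j),
-- let ρ i j be the block of its symbol minus the block of its column, modulo b.  On the top
-- b − r row blocks the hypothesis says ρ i j = block i.  On the bottom r row blocks ρ i j is
-- at least b − r: otherwise the m top rows of block ρ i j, together with row i, would put
-- m + 1 symbols of one symbol block into column j, which meets each symbol block only m times.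
-- Summing ρ over a k-plex gives a multiple of b, since the plex meets every column and every
-- symbol exactly k times.  But row by row the sum differs from k · Σᵢ block i = k m b (b − 1) / 2,
-- an odd multiple of b / 2, by at most k m r (r − 1) / 2 < b / 2.

open import Defs
open import Data.Nat as ℕ
  using (ℕ; zero; suc; _+_; _*_; _∸_; _<_; _≤_; _/_; _%_; NonZero; z≤n; s≤s)
open import Data.Nat.Properties hiding (_≟_)
open import Data.Nat.DivMod hiding (_div_)
open import Data.Nat.Divisibility as ∣ using (divides)
open import Data.Nat.Primality using (euclidsLemma; prime[2])
open import Data.Nat.Tactic.RingSolver using (solve-∀)
open import Data.Fin using (Fin; zero; suc; toℕ; _↑ˡ_; _↑ʳ_)
open import Data.Fin.Properties as Finₚ using (_≟_; toℕ<n; toℕ-↑ˡ; toℕ-↑ʳ)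
open import Data.Bool using (Bool; true; false; _∧_; if_then_else_)
import Data.Integer as ℤ
import Data.Integer.Properties as ℤ
open import Data.Product using (_×_; _,_; proj₁; proj₂)
open import Data.Sum using (inj₁; inj₂; [_,_]′)
open import Relation.Nullary using (¬_; Dec; yes; no; contradiction)
open import Relation.Nullary.Decidable using (⌊_⌋; isYes≗does; dec-true; dec-false)
open import Relation.Binary using (tri<; tri≈; tri>)
open import Relation.Binary.PropositionalEquality
open import Algebra.Properties.Semiring.Sum +-*-semiring
  using (sum; sum-syntax; sum-cong-≗; sum-replicate-zero; ∑-distrib-+; ∑-comm;
         *-distribˡ-sum; *-distribʳ-sum)

𝟙 : Bool → ℕ
𝟙 true  = 1
𝟙 false = 0

𝟙-∧ : ∀ x y → 𝟙 (x ∧ y) ≡ 𝟙 x * 𝟙 y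
𝟙-∧ true  y = sym (+-identityʳ (𝟙 y))
𝟙-∧ false y = refl

𝟙-yes : ∀ {A : Set} (a? : Dec A) → A → 𝟙 ⌊ a? ⌋ ≡ 1
𝟙-yes a? a = cong 𝟙 (trans (isYes≗does a?) (dec-true a? a))

𝟙-no : ∀ {A : Set} (a? : Dec A) → ¬ A → 𝟙 ⌊ a? ⌋ ≡ 0
𝟙-no a? ¬a = cong 𝟙 (trans (isYes≗does a?) (dec-false a? ¬a))

𝟙-⇔ : ∀ {A B : Set} (a? : Dec A) (b? : Dec B) → (A → B) → (B → A) → 𝟙 ⌊ a? ⌋ ≡ 𝟙 ⌊ b? ⌋
𝟙-⇔ a? (yes b) A→B B→A = 𝟙-yes a? (B→A b)
𝟙-⇔ a? (no ¬b) A→B B→A = 𝟙-no a? (λ a → ¬b (A→B a))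

sumFin≡∑ : ∀ {n} (f : Fin n → ℕ) → sumFin f ≡ sum f
sumFin≡∑ {zero}  f = refl
sumFin≡∑ {suc n} f = cong (f zero +_) (sumFin≡∑ (λ x → f (suc x)))

count≡∑𝟙 : ∀ {n} (p : Fin n → Bool) → count p ≡ ∑[ x < n ] 𝟙 (p x)
count≡∑𝟙 {zero}  p = refl
count≡∑𝟙 {suc n} p = cong₂ _+_ (if≡𝟙 (p zero)) (count≡∑𝟙 (λ x → p (suc x)))
  where
  if≡𝟙 : ∀ x → (if x then 1 else 0) ≡ 𝟙 x
  if≡𝟙 true  = refl
  if≡𝟙 false = refl

count₂≡∑∑𝟙 : ∀ {n} (p : Fin n → Fin n → Bool) →
  count₂ p ≡ ∑[ i < n ] ∑[ j < n ] 𝟙 (p i j)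
count₂≡∑∑𝟙 {n} p =
  trans (sumFin≡∑ (λ i → count (p i))) (sum-cong-≗ {n} (λ i → count≡∑𝟙 (p i)))

∑-mono-≤ : ∀ {n} {f g : Fin n → ℕ} → (∀ x → f x ≤ g x) → sum f ≤ sum g
∑-mono-≤ {zero}  f≤g = z≤n
∑-mono-≤ {suc n} f≤g = +-mono-≤ (f≤g zero) (∑-mono-≤ (λ x → f≤g (suc x)))

∑-const : ∀ n c → ∑[ _ < n ] c ≡ n * c
∑-const zero    c = refl
∑-const (suc n) c = cong (c +_) (∑-const n c)

∑-𝟙-≟ : ∀ {n} (x : Fin n) (f : Fin n → ℕ) → ∑[ s < n ] (𝟙 ⌊ x ≟ s ⌋ * f s) ≡ f x
∑-𝟙-≟ {suc n} zero f =
  trans (cong₂ _+_ (+-identityʳ (f zero)) (sum-replicate-zero n)) (+-identityʳ (f zero))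
∑-𝟙-≟ {suc n} (suc x) f = trans
  (sum-cong-≗ {n} (λ s →
    cong (_* f (suc s)) (𝟙-⇔ (suc x ≟ suc s) (x ≟ s) Finₚ.suc-injective (cong suc))))
  (∑-𝟙-≟ x (λ s → f (suc s)))

∑-↑ : ∀ a c (f : Fin (a + c) → ℕ) →
  sum f ≡ ∑[ x < a ] f (x ↑ˡ c) + ∑[ t < c ] f (a ↑ʳ t)
∑-↑ zero    c f = refl
∑-↑ (suc a) c f =
  trans (cong (f zero +_) (∑-↑ a c (λ x → f (suc x)))) (sym (+-assoc (f zero) _ _))

∑-toℕ-+ : ∀ a c (g : ℕ → ℕ) →
  ∑[ x < a + c ] g (toℕ x) ≡ ∑[ x < a ] g (toℕ x) + ∑[ t < c ] g (a + toℕ t)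
∑-toℕ-+ a c g = trans (∑-↑ a c (λ x → g (toℕ x))) (cong₂ _+_
  (sum-cong-≗ {a} (λ x → cong g (toℕ-↑ˡ x c)))
  (sum-cong-≗ {c} (λ t → cong g (toℕ-↑ʳ a t))))

∑-toℕ-/ : ∀ b m .{{_ : NonZero m}} (f : ℕ → ℕ) →
  ∑[ x < b * m ] f (toℕ x / m) ≡ m * ∑[ a < b ] f (toℕ a)
∑-toℕ-/ zero    m f = sym (*-zeroʳ m)
∑-toℕ-/ (suc b) m f = begin
  ∑[ x < m + b * m ] f (toℕ x / m)
    ≡⟨ ∑-toℕ-+ m (b * m) (λ y → f (y / m)) ⟩
  ∑[ x < m ] f (toℕ x / m) + ∑[ t < b * m ] f ((m + toℕ t) / m)
    ≡⟨ cong₂ _+_ (sum-cong-≗ {m} (λ x → cong f (m<n⇒m/n≡0 (toℕ<n x))))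
                 (sum-cong-≗ {b * m} (λ t → cong f ([m+y]/m≡1+y/m (toℕ t)))) ⟩
  ∑[ x < m ] f 0 + ∑[ t < b * m ] f (suc (toℕ t / m))
    ≡⟨ cong₂ _+_ (∑-const m (f 0)) (∑-toℕ-/ b m (λ a → f (suc a))) ⟩
  m * f 0 + m * ∑[ a < b ] f (suc (toℕ a))
    ≡⟨ *-distribˡ-+ m (f 0) _ ⟨
  m * ∑[ a < suc b ] f (toℕ a) ∎
  where
  open ≡-Reasoning
  [m+y]/m≡1+y/m : ∀ y → (m + y) / m ≡ suc (y / m)
  [m+y]/m≡1+y/m y =
    trans (m/n≡1+[m∸n]/n (m≤m+n m y)) (cong (λ z → suc (z / m)) (m+n∸m≡n m y))

∑-𝟙-toℕ≟ : ∀ b s → s < b → ∑[ a < b ] 𝟙 ⌊ toℕ a ℕ.≟ s ⌋ ≡ 1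
∑-𝟙-toℕ≟ (suc b) zero    _ = cong suc
  (trans (sum-cong-≗ {b} (λ a → 𝟙-no (suc (toℕ a) ℕ.≟ 0) λ ())) (sum-replicate-zero b))
∑-𝟙-toℕ≟ (suc b) (suc s) (s≤s s<b) = trans
  (sum-cong-≗ {b} (λ a →
    𝟙-⇔ (suc (toℕ a) ℕ.≟ suc s) (toℕ a ℕ.≟ s) suc-injective (cong suc)))
  (∑-𝟙-toℕ≟ b s s<b)

∑-toℕ-suc : ∀ r → ∑[ t < suc r ] toℕ t ≡ r + ∑[ t < r ] toℕ t
∑-toℕ-suc r = trans (∑-distrib-+ {r} (λ _ → 1) (λ t → toℕ t))
  (cong (_+ ∑[ t < r ] toℕ t) (trans (∑-const r 1) (*-identityʳ r)))

2*∑-toℕ : ∀ r → 2 * ∑[ t < r ] toℕ t ≡ r * (r ∸ 1)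
2*∑-toℕ zero    = refl
2*∑-toℕ (suc r) = begin
  2 * ∑[ t < suc r ] toℕ t      ≡⟨ cong (2 *_) (∑-toℕ-suc r) ⟩
  2 * (r + ∑[ t < r ] toℕ t)    ≡⟨ *-distribˡ-+ 2 r _ ⟩
  2 * r + 2 * ∑[ t < r ] toℕ t  ≡⟨ cong (2 * r +_) (2*∑-toℕ r) ⟩
  2 * r + r * (r ∸ 1)           ≡⟨ 2r+r[r∸1]≡[1+r]r r ⟩
  suc r * r                     ∎
  where
  open ≡-Reasoning
  2r+r[r∸1]≡[1+r]r : ∀ r → 2 * r + r * (r ∸ 1) ≡ suc r * r
  2r+r[r∸1]≡[1+r]r zero    = refl
  2r+r[r∸1]≡[1+r]r (suc r) = ring r
    where
    ring : ∀ r → 2 * suc r + suc r * r ≡ suc (suc r) * suc r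
    ring = solve-∀

∑-reverse-toℕ : ∀ r → ∑[ t < r ] (r ∸ suc (toℕ t)) ≡ ∑[ t < r ] toℕ t
∑-reverse-toℕ zero    = refl
∑-reverse-toℕ (suc r) = trans (cong (r +_) (∑-reverse-toℕ r)) (sym (∑-toℕ-suc r))

∑-toℕ∸ : ∀ c r → ∑[ a < c + r ] (toℕ a ∸ c) ≡ ∑[ t < r ] toℕ t
∑-toℕ∸ c r = trans (∑-toℕ-+ c r (_∸ c)) (cong₂ _+_
  (trans (sum-cong-≗ {c} (λ a → m≤n⇒m∸n≡0 (<⇒≤ (toℕ<n a)))) (sum-replicate-zero c))
  (sum-cong-≗ {r} (λ t → m+n∸m≡n c (toℕ t))))

∑-toℕ-above : ∀ c r →
  ∑[ a < c + r ] (𝟙 ⌊ c ≤? toℕ a ⌋ * (c + r ∸ suc (toℕ a))) ≡ ∑[ t < r ] toℕ t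
∑-toℕ-above c r = trans (∑-toℕ-+ c r (λ a → 𝟙 ⌊ c ≤? a ⌋ * (c + r ∸ suc a))) (cong₂ _+_
  (trans (sum-cong-≗ {c} below) (sum-replicate-zero c))
  (trans (sum-cong-≗ {r} above) (∑-reverse-toℕ r)))
  where
  open ≡-Reasoning
  below : ∀ a → 𝟙 ⌊ c ≤? toℕ a ⌋ * (c + r ∸ suc (toℕ a)) ≡ 0
  below a = cong (_* (c + r ∸ suc (toℕ a))) (𝟙-no (c ≤? toℕ a) (<⇒≱ (toℕ<n a)))
  above : ∀ t → 𝟙 ⌊ c ≤? c + toℕ t ⌋ * (c + r ∸ suc (c + toℕ t)) ≡ r ∸ suc (toℕ t)
  above t = begin
    𝟙 ⌊ c ≤? c + toℕ t ⌋ * (c + r ∸ suc (c + toℕ t))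
      ≡⟨ cong (_* (c + r ∸ suc (c + toℕ t))) (𝟙-yes (c ≤? c + toℕ t) (m≤m+n c (toℕ t))) ⟩
    1 * (c + r ∸ suc (c + toℕ t))   ≡⟨ *-identityˡ _ ⟩
    c + r ∸ suc (c + toℕ t)         ≡⟨ cong (c + r ∸_) (+-suc c (toℕ t)) ⟨
    c + r ∸ (c + suc (toℕ t))       ≡⟨ [m+n]∸[m+o]≡n∸o c r (suc (toℕ t)) ⟩
    r ∸ suc (toℕ t)                 ∎

module _ {d : ℕ} .{{_ : NonZero d}} where

  %-cong-+ : ∀ {x y u v} → x % d ≡ y % d → u % d ≡ v % d → (x + u) % d ≡ (y + v) % d
  %-cong-+ {x} {y} {u} {v} x≡y u≡v = begin
    (x + u) % d          ≡⟨ %-distribˡ-+ x u d ⟩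
    (x % d + u % d) % d  ≡⟨ cong₂ (λ p q → (p + q) % d) x≡y u≡v ⟩
    (y % d + v % d) % d  ≡⟨ %-distribˡ-+ y v d ⟨
    (y + v) % d          ∎
    where open ≡-Reasoning

  %-cong-* : ∀ c {x y} → x % d ≡ y % d → (c * x) % d ≡ (c * y) % d
  %-cong-* c {x} {y} x≡y = begin
    (c * x) % d            ≡⟨ %-distribˡ-* c x d ⟩
    (c % d * (x % d)) % d  ≡⟨ cong (λ p → (c % d * p) % d) x≡y ⟩
    (c % d * (y % d)) % d  ≡⟨ %-distribˡ-* c y d ⟨
    (c * y) % d            ∎
    where open ≡-Reasoning

  %-cong-∑ : ∀ {n} {f g : Fin n → ℕ} → (∀ x → f x % d ≡ g x % d) → sum f % d ≡ sum g % d
  %-cong-∑ {zero}  f≡g = refl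
  %-cong-∑ {suc n} f≡g = %-cong-+ (f≡g zero) (%-cong-∑ (λ x → f≡g (suc x)))

  %-cancelʳ-+ : ∀ {x y} z → (x + z) % d ≡ (y + z) % d → x % d ≡ y % d
  %-cancelʳ-+ {x} {y} z x+z≡y+z = begin
    x % d                      ≡⟨ [m+kn]%n≡m%n x z d ⟨
    (x + z * d) % d            ≡⟨ cong (_% d) (pad x) ⟩
    (x + z + (z * d ∸ z)) % d  ≡⟨ %-cong-+ x+z≡y+z refl ⟩
    (y + z + (z * d ∸ z)) % d  ≡⟨ cong (_% d) (pad y) ⟨
    (y + z * d) % d            ≡⟨ [m+kn]%n≡m%n y z d ⟩
    y % d                      ∎
    where
    open ≡-Reasoning
    pad : ∀ w → w + z * d ≡ w + z + (z * d ∸ z)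
    pad w = trans (cong (w +_) (sym (m+[n∸m]≡n (m≤m*n z d)))) (sym (+-assoc w z _))

  ∸-∣⇒%≡ : ∀ {x y} → y ≤ x → d ∣.∣ x ∸ y → x % d ≡ y % d
  ∸-∣⇒%≡ {x} {y} y≤x d∣x∸y = begin
    x % d              ≡⟨ cong (_% d) (m+[n∸m]≡n y≤x) ⟨
    (y + (x ∸ y)) % d  ≡⟨ %-remove-+ʳ y d∣x∸y ⟩
    y % d              ∎
    where open ≡-Reasoning

  [mod]⇒%≡ : ∀ {x y} → x ≡ y [mod d ] → x % d ≡ y % d
  [mod]⇒%≡ {x} {y} d∣x-y with ≤-total y x
  ... | inj₁ y≤x = ∸-∣⇒%≡ y≤x (subst (d ∣.∣_) ∣x-y∣≡x∸y d∣x-y)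
    where
    ∣x-y∣≡x∸y : ℤ.∣ ℤ.+ x ℤ.- ℤ.+ y ∣ ≡ x ∸ y
    ∣x-y∣≡x∸y = cong ℤ.∣_∣ (trans (ℤ.m-n≡m⊖n x y) (ℤ.⊖-≥ y≤x))
  ... | inj₂ x≤y = sym (∸-∣⇒%≡ x≤y (subst (d ∣.∣_) ∣x-y∣≡y∸x d∣x-y))
    where
    ∣x-y∣≡y∸x : ℤ.∣ ℤ.+ x ℤ.- ℤ.+ y ∣ ≡ y ∸ x
    ∣x-y∣≡y∸x = trans (cong ℤ.∣_∣ (ℤ.m-n≡m⊖n x y)) (ℤ.∣⊖∣-≤ x≤y)

module _ (d : ℕ) .{{_ : NonZero d}} where

  modSub : ℕ → ℕ → ℕ
  modSub x c = (x + (d ∸ c)) % d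

  modSub<d : ∀ x c → modSub x c < d
  modSub<d x c = m%n<n (x + (d ∸ c)) d

  modSub-+ : ∀ x {c} → c ≤ d → (modSub x c + c) % d ≡ x % d
  modSub-+ x {c} c≤d = begin
    ((x + (d ∸ c)) % d + c) % d  ≡⟨ %-cong-+ (m%n%n≡m%n (x + (d ∸ c)) d) refl ⟩
    (x + (d ∸ c) + c) % d        ≡⟨ cong (_% d) (trans (+-assoc x _ c) (cong (x +_) (m∸n+n≡m c≤d))) ⟩
    (x + d) % d                  ≡⟨ [m+n]%n≡m%n x d ⟩
    x % d                        ∎
    where open ≡-Reasoning

  modSub-unique : ∀ x {a c} → a < d → c ≤ d → x % d ≡ (a + c) % d → modSub x c ≡ a
  modSub-unique x {a} {c} a<d c≤d x≡a+c = begin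
    (x + (d ∸ c)) % d      ≡⟨ %-cong-+ x≡a+c refl ⟩
    (a + c + (d ∸ c)) % d  ≡⟨ cong (_% d) (trans (+-assoc a c _) (cong (a +_) (m+[n∸m]≡n c≤d))) ⟩
    (a + d) % d            ≡⟨ [m+n]%n≡m%n a d ⟩
    a % d                  ≡⟨ m<n⇒m%n≡m a<d ⟩
    a                      ∎
    where open ≡-Reasoning

  modSub-injective : ∀ {x y c} → x < d → y < d → c ≤ d → modSub x c ≡ modSub y c → x ≡ y
  modSub-injective {x} {y} {c} x<d y<d c≤d x-c≡y-c = begin
    x                     ≡⟨ m<n⇒m%n≡m x<d ⟨
    x % d                 ≡⟨ modSub-+ x c≤d ⟨
    (modSub x c + c) % d  ≡⟨ cong (λ z → (z + c) % d) x-c≡y-c ⟩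
    (modSub y c + c) % d  ≡⟨ modSub-+ y c≤d ⟩
    y % d                 ≡⟨ m<n⇒m%n≡m y<d ⟩
    y                     ∎
    where open ≡-Reasoning

odd-* : ∀ {x y} → Odd x → Odd y → Odd (x * y)
odd-* {x} {y} odd-x odd-y 2∣xy = [ odd-x , odd-y ]′ (euclidsLemma x y prime[2] 2∣xy)

even-suc⇒odd : ∀ {x} → Even (suc x) → Odd x
even-suc⇒odd {x} 2∣1+x 2∣x =
  contradiction (∣.∣1⇒≡1 (∣.∣m+n∣m⇒∣n (subst (2 ∣.∣_) (+-comm 1 x) 2∣1+x) 2∣x)) λ ()

odd-multiple-far : ∀ {q w P E} → Odd w → q * 2 ∣.∣ P →
  q * w ≤ P + E → P ≤ q * w + E → q ≤ E
odd-multiple-far {q} {w} {E = E} odd-w (divides W refl) qw≤P+E P≤qw+E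
  with <-cmp (2 * W) w
... | tri< 2W<w _ _ = +-cancelˡ-≤ (W * (q * 2)) q E (begin
  W * (q * 2) + q  ≡⟨ ring W q ⟩
  q * suc (2 * W)  ≤⟨ *-monoʳ-≤ q 2W<w ⟩
  q * w            ≤⟨ qw≤P+E ⟩
  W * (q * 2) + E  ∎)
  where
  open ≤-Reasoning
  ring : ∀ W q → W * (q * 2) + q ≡ q * suc (2 * W)
  ring = solve-∀
... | tri≈ _ 2W≡w _ = contradiction (divides W (trans (sym 2W≡w) (*-comm 2 W))) odd-w
... | tri> _ _ w<2W = +-cancelˡ-≤ (q * w) q E (begin
  q * w + q    ≡⟨ ring q w ⟩
  q * suc w    ≤⟨ *-monoʳ-≤ q w<2W ⟩
  q * (2 * W)  ≡⟨ ring′ q W ⟩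
  W * (q * 2)  ≤⟨ P≤qw+E ⟩
  q * w + E    ∎)
  where
  open ≤-Reasoning
  ring : ∀ q w → q * w + q ≡ q * suc w
  ring = solve-∀
  ring′ : ∀ q W → q * (2 * W) ≡ W * (q * 2)
  ring′ = solve-∀

c*m*[m∸1]<n⇒m≤n : ∀ {c m n} → 0 < c → c * m * (m ∸ 1) < n → m ≤ n
c*m*[m∸1]<n⇒m≤n {m = zero}  0<c _ = z≤n
c*m*[m∸1]<n⇒m≤n {c} {suc m} {n} 0<c cm[m∸1]<n =
  subst (_< n) (*-identityˡ m) (≤-<-trans (*-monoˡ-≤ m 1≤c*[1+m]) cm[m∸1]<n)
  where
  1≤c*[1+m] : 1 ≤ c * suc m
  1≤c*[1+m] = *-mono-≤ 0<c (s≤s z≤n)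

size-bounds : ∀ {b m r k} .{{_ : NonZero m}} → 0 < k → k * (m * m) * r * (r ∸ 1) < b * m →
  r ≤ b × k * (m * ∑[ t < r ] toℕ t) * 2 < b
size-bounds {b} {m} {r} {k} 0<k kmmr[r∸1]<bm =
  c*m*[m∸1]<n⇒m≤n (*-mono-≤ 0<k (ℕ.>-nonZero⁻¹ m)) kmr[r∸1]<b ,
  subst (_< b) kmr[r∸1]≡2D kmr[r∸1]<b
  where
  kmr[r∸1]<b : k * m * r * (r ∸ 1) < b
  kmr[r∸1]<b = *-cancelʳ-< m _ b (subst (_< b * m) (ring k m r (r ∸ 1)) kmmr[r∸1]<bm)
    where
    ring : ∀ k m r s → k * (m * m) * r * s ≡ k * m * r * s * m
    ring = solve-∀
  kmr[r∸1]≡2D : k * m * r * (r ∸ 1) ≡ k * (m * ∑[ t < r ] toℕ t) * 2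
  kmr[r∸1]≡2D = begin
    k * m * r * (r ∸ 1)             ≡⟨ *-assoc (k * m) r (r ∸ 1) ⟩
    k * m * (r * (r ∸ 1))           ≡⟨ cong (k * m *_) (2*∑-toℕ r) ⟨
    k * m * (2 * ∑[ t < r ] toℕ t)  ≡⟨ ring k m (∑[ t < r ] toℕ t) ⟩
    k * (m * ∑[ t < r ] toℕ t) * 2  ∎
    where
    open ≡-Reasoning
    ring : ∀ k m T → k * m * (2 * T) ≡ k * (m * T) * 2
    ring = solve-∀

module Blocks (b m : ℕ) .{{_ : NonZero b}} .{{_ : NonZero m}} where

  n : ℕ
  n = b * m

  block : Fin n → ℕ
  block x = toℕ x / m

  block<b : ∀ x → block x < b
  block<b x = m<n*o⇒m/o<n (toℕ<n x)

  ∑-block : ∀ (f : ℕ → ℕ) → ∑[ x < n ] f (block x) ≡ m * ∑[ a < b ] f (toℕ a)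
  ∑-block = ∑-toℕ-/ b m

  block-size : ∀ {a} → a < b → ∑[ x < n ] 𝟙 ⌊ block x ℕ.≟ a ⌋ ≡ m
  block-size {a} a<b = begin
    ∑[ x < n ] 𝟙 ⌊ block x ℕ.≟ a ⌋    ≡⟨ ∑-block (λ y → 𝟙 ⌊ y ℕ.≟ a ⌋) ⟩
    m * ∑[ c < b ] 𝟙 ⌊ toℕ c ℕ.≟ a ⌋  ≡⟨ cong (m *_) (∑-𝟙-toℕ≟ b a a<b) ⟩
    m * 1                             ≡⟨ *-identityʳ m ⟩
    m                                 ∎
    where open ≡-Reasoning

  ∑-block-even : ∀ {q} → b ≡ q * 2 → sum block ≡ q * (m * (b ∸ 1))
  ∑-block-even {q} b≡q*2 = *-cancelˡ-≡ _ _ 2 (begin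
    2 * sum block               ≡⟨ cong (2 *_) (∑-block (λ a → a)) ⟩
    2 * (m * ∑[ a < b ] toℕ a)  ≡⟨ ring₁ m (∑[ a < b ] toℕ a) ⟩
    m * (2 * ∑[ a < b ] toℕ a)  ≡⟨ cong (m *_) (2*∑-toℕ b) ⟩
    m * (b * (b ∸ 1))           ≡⟨ cong (λ z → m * (z * (b ∸ 1))) b≡q*2 ⟩
    m * (q * 2 * (b ∸ 1))       ≡⟨ ring₂ m q (b ∸ 1) ⟩
    2 * (q * (m * (b ∸ 1)))     ∎)
    where
    open ≡-Reasoning
    ring₁ : ∀ m T → 2 * (m * T) ≡ m * (2 * T)
    ring₁ = solve-∀
    ring₂ : ∀ m q c → m * (q * 2 * c) ≡ 2 * (q * (m * c))
    ring₂ = solve-∀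

  ∑-≤-block-gaps : ∀ k {u v : Fin n → ℕ} (gap : ℕ → ℕ) →
    (∀ x → u x ≤ v x + k * gap (block x)) →
    sum u ≤ sum v + k * (m * ∑[ a < b ] gap (toℕ a))
  ∑-≤-block-gaps k {u} {v} gap u≤v+gap = begin
    sum u                                     ≤⟨ ∑-mono-≤ u≤v+gap ⟩
    ∑[ x < n ] (v x + k * gap (block x))      ≡⟨ ∑-distrib-+ v (λ x → k * gap (block x)) ⟩
    sum v + ∑[ x < n ] (k * gap (block x))
      ≡⟨ cong (sum v +_) (*-distribˡ-sum k (λ x → gap (block x))) ⟨
    sum v + k * ∑[ x < n ] gap (block x)      ≡⟨ cong (λ z → sum v + k * z) (∑-block gap) ⟩
    sum v + k * (m * ∑[ a < b ] gap (toℕ a))  ∎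
    where open ≤-Reasoning

  module Latin (L : Square n) (latin : IsLatin L) where

    ∑-column : ∀ j (g : Fin n → ℕ) → ∑[ i < n ] g (L i j) ≡ sum g
    ∑-column j g = begin
      ∑[ i < n ] g (L i j)
        ≡⟨ sum-cong-≗ {n} (λ i → ∑-𝟙-≟ (L i j) g) ⟨
      ∑[ i < n ] ∑[ s < n ] (𝟙 ⌊ L i j ≟ s ⌋ * g s)
        ≡⟨ ∑-comm (λ i s → 𝟙 ⌊ L i j ≟ s ⌋ * g s) ⟩
      ∑[ s < n ] ∑[ i < n ] (𝟙 ⌊ L i j ≟ s ⌋ * g s)
        ≡⟨ sum-cong-≗ {n} (λ s → *-distribʳ-sum (g s) (λ i → 𝟙 ⌊ L i j ≟ s ⌋)) ⟨
      ∑[ s < n ] (∑[ i < n ] 𝟙 ⌊ L i j ≟ s ⌋ * g s)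
        ≡⟨ sum-cong-≗ {n} (λ s → cong (_* g s) (once s)) ⟩
      ∑[ s < n ] (1 * g s)
        ≡⟨ sum-cong-≗ {n} (λ s → *-identityˡ (g s)) ⟩
      sum g ∎
      where
      open ≡-Reasoning
      once : ∀ s → ∑[ i < n ] 𝟙 ⌊ L i j ≟ s ⌋ ≡ 1
      once s = trans (sym (count≡∑𝟙 (λ i → ⌊ L i j ≟ s ⌋))) (proj₂ latin j s)

    column-block-size : ∀ j {a} → a < b → ∑[ i < n ] 𝟙 ⌊ block (L i j) ℕ.≟ a ⌋ ≡ m
    column-block-size j a<b = trans (∑-column j _) (block-size a<b)

    module Plex (k : ℕ) (K : Fin n → Fin n → Bool) (plex : IsKPlex L k K) where

      ∑ₖ : (Fin n → Fin n → ℕ) → ℕ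
      ∑ₖ f = ∑[ i < n ] ∑[ j < n ] (𝟙 (K i j) * f i j)

      ∑ₖ-+ : ∀ f g → ∑ₖ (λ i j → f i j + g i j) ≡ ∑ₖ f + ∑ₖ g
      ∑ₖ-+ f g = trans
        (sum-cong-≗ {n} (λ i → trans
          (sum-cong-≗ {n} (λ j → *-distribˡ-+ (𝟙 (K i j)) (f i j) (g i j)))
          (∑-distrib-+ (λ j → 𝟙 (K i j) * f i j) (λ j → 𝟙 (K i j) * g i j))))
        (∑-distrib-+ (λ i → ∑[ j < n ] (𝟙 (K i j) * f i j))
                     (λ i → ∑[ j < n ] (𝟙 (K i j) * g i j)))

      ∑ₖ-row : ∀ i c → ∑[ j < n ] (𝟙 (K i j) * c) ≡ k * c
      ∑ₖ-row i c = trans (sym (*-distribʳ-sum c (λ j → 𝟙 (K i j))))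
        (cong (_* c) (trans (sym (count≡∑𝟙 (K i))) (proj₁ plex i)))

      ∑ₖ-row-≤ : ∀ i {f : Fin n → ℕ} {c} → (∀ j → f j ≤ c) →
        ∑[ j < n ] (𝟙 (K i j) * f j) ≤ k * c
      ∑ₖ-row-≤ i f≤c =
        ≤-trans (∑-mono-≤ (λ j → *-monoʳ-≤ (𝟙 (K i j)) (f≤c j))) (≤-reflexive (∑ₖ-row i _))

      ∑ₖ-row-≥ : ∀ i {f : Fin n → ℕ} {c} → (∀ j → c ≤ f j) →
        k * c ≤ ∑[ j < n ] (𝟙 (K i j) * f j)
      ∑ₖ-row-≥ i c≤f =
        ≤-trans (≤-reflexive (sym (∑ₖ-row i _))) (∑-mono-≤ (λ j → *-monoʳ-≤ (𝟙 (K i j)) (c≤f j)))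

      ∑ₖ-column : ∀ g → ∑ₖ (λ _ j → g j) ≡ k * sum g
      ∑ₖ-column g = begin
        ∑[ i < n ] ∑[ j < n ] (𝟙 (K i j) * g j)
          ≡⟨ ∑-comm (λ i j → 𝟙 (K i j) * g j) ⟩
        ∑[ j < n ] ∑[ i < n ] (𝟙 (K i j) * g j)
          ≡⟨ sum-cong-≗ {n} (λ j → *-distribʳ-sum (g j) (λ i → 𝟙 (K i j))) ⟨
        ∑[ j < n ] (∑[ i < n ] 𝟙 (K i j) * g j)
          ≡⟨ sum-cong-≗ {n} (λ j → cong (_* g j) (column j)) ⟩
        ∑[ j < n ] (k * g j)
          ≡⟨ *-distribˡ-sum k g ⟨
        k * sum g ∎
        where
        open ≡-Reasoning
        column : ∀ j → ∑[ i < n ] 𝟙 (K i j) ≡ k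
        column j = trans (sym (count≡∑𝟙 (λ i → K i j))) (proj₁ (proj₂ plex) j)

      ∑ₖ-symbol : ∀ g → ∑ₖ (λ i j → g (L i j)) ≡ k * sum g
      ∑ₖ-symbol g = begin
        ∑[ i < n ] ∑[ j < n ] (𝟙 (K i j) * g (L i j))
          ≡⟨ sum-cong-≗ {n} (λ i → sum-cong-≗ {n} (cell i)) ⟩
        ∑[ i < n ] ∑[ j < n ] ∑[ s < n ] (hit i j s * g s)
          ≡⟨ sum-cong-≗ {n} (λ i → ∑-comm (λ j s → hit i j s * g s)) ⟩
        ∑[ i < n ] ∑[ s < n ] ∑[ j < n ] (hit i j s * g s)
          ≡⟨ ∑-comm (λ i s → ∑[ j < n ] (hit i j s * g s)) ⟩
        ∑[ s < n ] ∑[ i < n ] ∑[ j < n ] (hit i j s * g s)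
          ≡⟨ sum-cong-≗ {n} factor ⟨
        ∑[ s < n ] (∑[ i < n ] ∑[ j < n ] hit i j s * g s)
          ≡⟨ sum-cong-≗ {n} (λ s → cong (_* g s) (symbol s)) ⟩
        ∑[ s < n ] (k * g s)
          ≡⟨ *-distribˡ-sum k g ⟨
        k * sum g ∎
        where
        open ≡-Reasoning
        hit : Fin n → Fin n → Fin n → ℕ
        hit i j s = 𝟙 (K i j ∧ ⌊ L i j ≟ s ⌋)
        cell : ∀ i j → 𝟙 (K i j) * g (L i j) ≡ ∑[ s < n ] (hit i j s * g s)
        cell i j = begin
          𝟙 (K i j) * g (L i j)
            ≡⟨ cong (𝟙 (K i j) *_) (∑-𝟙-≟ (L i j) g) ⟨
          𝟙 (K i j) * ∑[ s < n ] (𝟙 ⌊ L i j ≟ s ⌋ * g s)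
            ≡⟨ *-distribˡ-sum (𝟙 (K i j)) (λ s → 𝟙 ⌊ L i j ≟ s ⌋ * g s) ⟩
          ∑[ s < n ] (𝟙 (K i j) * (𝟙 ⌊ L i j ≟ s ⌋ * g s))
            ≡⟨ sum-cong-≗ {n} (λ s → sym (*-assoc (𝟙 (K i j)) _ (g s))) ⟩
          ∑[ s < n ] (𝟙 (K i j) * 𝟙 ⌊ L i j ≟ s ⌋ * g s)
            ≡⟨ sum-cong-≗ {n} (λ s → cong (_* g s) (𝟙-∧ (K i j) _)) ⟨
          ∑[ s < n ] (hit i j s * g s) ∎
        factor : ∀ s → ∑[ i < n ] ∑[ j < n ] hit i j s * g s ≡
                       ∑[ i < n ] ∑[ j < n ] (hit i j s * g s)
        factor s = trans (*-distribʳ-sum (g s) (λ i → ∑[ j < n ] hit i j s))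
          (sum-cong-≗ {n} (λ i → *-distribʳ-sum (g s) (λ j → hit i j s)))
        symbol : ∀ s → ∑[ i < n ] ∑[ j < n ] hit i j s ≡ k
        symbol s = trans (sym (count₂≡∑∑𝟙 (λ i j → K i j ∧ ⌊ L i j ≟ s ⌋)))
                         (proj₂ (proj₂ plex) s)

    module Additive (r : ℕ)
      (additive : ∀ i j → toℕ i < n ∸ m * r → block (L i j) % b ≡ (block i + block j) % b)
      where

      -- The row block that the additive rule would assign to cell (i, j).
      ρ : Fin n → Fin n → ℕ
      ρ i j = modSub b (block (L i j)) (block j)

      ρ<b : ∀ i j → ρ i j < b
      ρ<b i j = modSub<d b (block (L i j)) (block j)

      ρ-+ : ∀ i j → (ρ i j + block j) % b ≡ block (L i j) % b
      ρ-+ i j = modSub-+ b (block (L i j)) (<⇒≤ (block<b j))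

      top-row : ∀ i → block i < b ∸ r → toℕ i < n ∸ m * r
      top-row i top = begin-strict
        toℕ i                    ≡⟨ m≡m%n+[m/n]*n (toℕ i) m ⟩
        toℕ i % m + block i * m  <⟨ +-monoˡ-< (block i * m) (m%n<n (toℕ i) m) ⟩
        suc (block i) * m        ≤⟨ *-monoˡ-≤ m top ⟩
        (b ∸ r) * m              ≡⟨ *-distribʳ-∸ m b r ⟩
        b * m ∸ r * m            ≡⟨ cong (n ∸_) (*-comm r m) ⟩
        n ∸ m * r                ∎
        where open ≤-Reasoning

      ρ-top : ∀ i j → block i < b ∸ r → ρ i j ≡ block i
      ρ-top i j top =
        modSub-unique b _ (block<b i) (<⇒≤ (block<b j)) (additive i j (top-row i top))

      -- Every row i′ of the top block ρ i j gets ρ i′ j = ρ i j, hence a symbol in the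
      -- block of L i j; the bottom row i is one more.
      column-overfull : ∀ i j → b ∸ r ≤ block i → ρ i j < b ∸ r →
        m + 1 ≤ ∑[ i′ < n ] 𝟙 ⌊ block (L i′ j) ℕ.≟ block (L i j) ⌋
      column-overfull i j bottom ρ-top-block = begin
        m + 1
          ≡⟨ cong₂ _+_ (block-size (ρ<b i j)) (∑-𝟙-≟ i (λ _ → 1)) ⟨
        ∑[ i′ < n ] 𝟙 ⌊ block i′ ℕ.≟ ρ i j ⌋ + ∑[ i′ < n ] (𝟙 ⌊ i ≟ i′ ⌋ * 1)
          ≡⟨ ∑-distrib-+ (λ i′ → 𝟙 ⌊ block i′ ℕ.≟ ρ i j ⌋) (λ i′ → 𝟙 ⌊ i ≟ i′ ⌋ * 1) ⟨
        ∑[ i′ < n ] (𝟙 ⌊ block i′ ℕ.≟ ρ i j ⌋ + 𝟙 ⌊ i ≟ i′ ⌋ * 1)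
          ≤⟨ ∑-mono-≤ same-symbol-block ⟩
        ∑[ i′ < n ] 𝟙 ⌊ block (L i′ j) ℕ.≟ block (L i j) ⌋ ∎
        where
        open ≤-Reasoning
        same-symbol-block : ∀ i′ →
          𝟙 ⌊ block i′ ℕ.≟ ρ i j ⌋ + 𝟙 ⌊ i ≟ i′ ⌋ * 1 ≤ 𝟙 ⌊ block (L i′ j) ℕ.≟ block (L i j) ⌋
        same-symbol-block i′ with block i′ ℕ.≟ ρ i j | i ≟ i′
        ... | yes i′∈ρ | yes refl =
          contradiction (subst (_< b ∸ r) (sym i′∈ρ) ρ-top-block) (≤⇒≯ bottom)
        ... | yes i′∈ρ | no _ = ≤-reflexive (sym (𝟙-yes (_ ℕ.≟ _)
          (modSub-injective b (block<b (L i′ j)) (block<b (L i j)) (<⇒≤ (block<b j))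
            (trans (ρ-top i′ j (subst (_< b ∸ r) (sym i′∈ρ) ρ-top-block)) i′∈ρ))))
        ... | no _ | yes refl = ≤-reflexive (sym (𝟙-yes (_ ℕ.≟ _) refl))
        ... | no _ | no _     = z≤n

      ρ-bottom : ∀ i j → b ∸ r ≤ block i → b ∸ r ≤ ρ i j
      ρ-bottom i j bottom with b ∸ r ≤? ρ i j
      ... | yes ρ-bottom-block = ρ-bottom-block
      ... | no  ρ-top-block    = contradiction
        (≤-trans (column-overfull i j bottom (≰⇒> ρ-top-block))
                 (≤-reflexive (column-block-size j (block<b (L i j)))))
        (m+1+n≰m m)

      module _ (k : ℕ) (K : Fin n → Fin n → Bool) (plex : IsKPlex L k K) where
        open Plex k K plex

        ∑ₖρ-multiple : b ∣.∣ ∑ₖ ρ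
        ∑ₖρ-multiple = ∣.m%n≡0⇒n∣m (∑ₖ ρ) b
          (trans (%-cancelʳ-+ {x = ∑ₖ ρ} {y = 0} (k * sum block) shifted)
                 (m<n⇒m%n≡m (ℕ.>-nonZero⁻¹ b)))
          where
          open ≡-Reasoning
          shifted : (∑ₖ ρ + k * sum block) % b ≡ (k * sum block) % b
          shifted = begin
            (∑ₖ ρ + k * sum block) % b
              ≡⟨ cong (λ z → (∑ₖ ρ + z) % b) (∑ₖ-column block) ⟨
            (∑ₖ ρ + ∑ₖ (λ _ j → block j)) % b
              ≡⟨ cong (_% b) (∑ₖ-+ ρ (λ _ j → block j)) ⟨
            ∑ₖ (λ i j → ρ i j + block j) % b
              ≡⟨ %-cong-∑ (λ i → %-cong-∑ (λ j → %-cong-* (𝟙 (K i j)) (ρ-+ i j))) ⟩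
            ∑ₖ (λ i j → block (L i j)) % b
              ≡⟨ cong (_% b) (∑ₖ-symbol block) ⟩
            (k * sum block) % b ∎

        ρ-row : Fin n → ℕ
        ρ-row i = ∑[ j < n ] (𝟙 (K i j) * ρ i j)

        ρ-row-top : ∀ i → block i < b ∸ r → ρ-row i ≡ k * block i
        ρ-row-top i top = trans
          (sum-cong-≗ {n} (λ j → cong (𝟙 (K i j) *_) (ρ-top i j top))) (∑ₖ-row i (block i))

        ρ-row-≥ : ∀ i → k * block i ≤ ρ-row i + k * (block i ∸ (b ∸ r))
        ρ-row-≥ i with b ∸ r ≤? block i
        ... | no  top    = ≤-trans (≤-reflexive (sym (ρ-row-top i (≰⇒> top)))) (m≤m+n _ _)
        ... | yes bottom = begin
          k * block i                            ≡⟨ cong (k *_) (m+[n∸m]≡n bottom) ⟨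
          k * (b ∸ r + (block i ∸ (b ∸ r)))      ≡⟨ *-distribˡ-+ k (b ∸ r) _ ⟩
          k * (b ∸ r) + k * (block i ∸ (b ∸ r))
            ≤⟨ +-monoˡ-≤ _ (∑ₖ-row-≥ i (λ j → ρ-bottom i j bottom)) ⟩
          ρ-row i + k * (block i ∸ (b ∸ r))      ∎
          where open ≤-Reasoning

        ρ-row-≤ : ∀ i →
          ρ-row i ≤ k * block i + k * (𝟙 ⌊ b ∸ r ≤? block i ⌋ * (b ∸ suc (block i)))
        ρ-row-≤ i with b ∸ r ≤? block i
        ... | no  top = ≤-trans (≤-reflexive (ρ-row-top i (≰⇒> top))) (m≤m+n _ _)
        ... | yes _   = begin
          ρ-row i                                      ≤⟨ ∑ₖ-row-≤ i ρ≤ ⟩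
          k * (block i + (b ∸ suc (block i)))          ≡⟨ *-distribˡ-+ k (block i) _ ⟩
          k * block i + k * (b ∸ suc (block i))
            ≡⟨ cong (λ z → k * block i + k * z) (*-identityˡ _) ⟨
          k * block i + k * (1 * (b ∸ suc (block i)))  ∎
          where
          open ≤-Reasoning
          ρ≤ : ∀ j → ρ i j ≤ block i + (b ∸ suc (block i))
          ρ≤ j = ℕ.s≤s⁻¹ (subst (ρ i j <_) (sym (m+[n∸m]≡n (block<b i))) (ρ<b i j))

        ∑ₖρ-≥ : r ≤ b → k * sum block ≤ ∑ₖ ρ + k * (m * ∑[ t < r ] toℕ t)
        ∑ₖρ-≥ r≤b = begin
          k * sum block
            ≡⟨ *-distribˡ-sum k block ⟩
          ∑[ i < n ] (k * block i)
            ≤⟨ ∑-≤-block-gaps k (_∸ (b ∸ r)) ρ-row-≥ ⟩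
          ∑ₖ ρ + k * (m * ∑[ a < b ] (toℕ a ∸ (b ∸ r)))
            ≡⟨ cong (λ z → ∑ₖ ρ + k * (m * z)) gaps ⟩
          ∑ₖ ρ + k * (m * ∑[ t < r ] toℕ t) ∎
          where
          open ≤-Reasoning
          gaps : ∑[ a < b ] (toℕ a ∸ (b ∸ r)) ≡ ∑[ t < r ] toℕ t
          gaps = subst (λ z → ∑[ a < z ] (toℕ a ∸ (b ∸ r)) ≡ ∑[ t < r ] toℕ t)
                   (m∸n+n≡m r≤b) (∑-toℕ∸ (b ∸ r) r)

        ∑ₖρ-≤ : r ≤ b → ∑ₖ ρ ≤ k * sum block + k * (m * ∑[ t < r ] toℕ t)
        ∑ₖρ-≤ r≤b = begin
          ∑ₖ ρ
            ≤⟨ ∑-≤-block-gaps k gap ρ-row-≤ ⟩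
          ∑[ i < n ] (k * block i) + k * (m * ∑[ a < b ] gap (toℕ a))
            ≡⟨ cong₂ (λ x z → x + k * (m * z)) (*-distribˡ-sum k block) (sym gaps) ⟨
          k * sum block + k * (m * ∑[ t < r ] toℕ t) ∎
          where
          open ≤-Reasoning
          gap : ℕ → ℕ
          gap a = 𝟙 ⌊ b ∸ r ≤? a ⌋ * (b ∸ suc a)
          gaps : ∑[ a < b ] gap (toℕ a) ≡ ∑[ t < r ] toℕ t
          gaps = subst
            (λ z → ∑[ a < z ] (𝟙 ⌊ b ∸ r ≤? toℕ a ⌋ * (z ∸ suc (toℕ a))) ≡ ∑[ t < r ] toℕ t)
            (m∸n+n≡m r≤b) (∑-toℕ-above (b ∸ r) r)

theorem2p3 : (n b m r k : ℕ) → n ≡ b * m → Even b → Odd m → Odd k → 0 < k →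
    (L : Square n) → IsLatin L →
    (∀ (i j : Fin n) → toℕ i < n ∸ m * r →
      (toℕ (L i j) div m) ≡ (toℕ i div m) + (toℕ j div m) [mod b ]) →
    k * (m * m) * r * (r ∸ 1) < n →
    ¬ HasKPlex L k
theorem2p3 n zero     m        r k refl _ _     _ _ _ _ _ size<0 _ = n≮0 size<0
theorem2p3 n (suc b₀) zero     r k refl _ odd-0 _ _ _ _ _ _      _ = odd-0 (∣.divides 0 refl)
theorem2p3 n (suc b₀) (suc m₀) r k refl (divides q b≡q*2) odd-m odd-k 0<k
           L latin additive size<n (K , plex) =
  <⇒≱ D<q (odd-multiple-far odd-km[b∸1]
    (subst (∣._∣ ∑ₖ ρ) b≡q*2 (∑ₖρ-multiple k K plex))
    (subst (_≤ ∑ₖ ρ + D) kS≡q*km[b∸1] (∑ₖρ-≥ k K plex r≤b))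
    (subst (λ x → ∑ₖ ρ ≤ x + D) kS≡q*km[b∸1] (∑ₖρ-≤ k K plex r≤b)))
  where
  open Blocks (suc b₀) (suc m₀)
  open Latin L latin
  open Plex k K plex
  open Additive r (λ i j top → [mod]⇒%≡ {x = block (L i j)} {y = block i + block j}
                                         (additive i j top))
  D : ℕ
  D = k * (suc m₀ * ∑[ t < r ] toℕ t)
  r≤b : r ≤ suc b₀
  r≤b = proj₁ (size-bounds 0<k size<n)
  D<q : D < q
  D<q = *-cancelʳ-< 2 D q (subst (D * 2 <_) b≡q*2 (proj₂ (size-bounds 0<k size<n)))
  odd-km[b∸1] : Odd (k * suc m₀ * b₀)
  odd-km[b∸1] = odd-* (odd-* odd-k odd-m) (even-suc⇒odd (divides q b≡q*2))
  kS≡q*km[b∸1] : k * sum block ≡ q * (k * suc m₀ * b₀)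
  kS≡q*km[b∸1] = trans (cong (k *_) (∑-block-even {q} b≡q*2)) (ring k q (suc m₀) b₀)
    where
    ring : ∀ k q m c → k * (q * (m * c)) ≡ q * (k * m * c)
    ring = solve-∀
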